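{- Let $n \geq 6$ and let $G = CS_{5,n-5}$ be the cycle-star graph with cycle length $k=5$ and $n-k \geq 1$ pendant vertices. Then $es(G) = n-2$ if $n = 6$, and $es(G) = n-3$ if $n \geq 7$.
   Context: For integers $k \geq 3$ and $n > k$, the cycle-star graph $CS_{k,n-k}$ is the simple graph on $n$ vertices consisting of a cycle of length $k$ together with $n-k$ additional vertices of degree one (leaves), all adjacent to the same single vertex of the cycle. For a simple graph $G$, a vertex $k$-labeling is a map $\phi: V(G) \to \{1,2,\ldots,k\}$; the weight of an edge $uv$ is $w_\phi(uv) = \phi(u)+\phi(v)$. The labeling is an edge irregular $k$-labeling if distinct edges have distinct weights. The edge irregularity strength $es(G)$ is the minimum $k$ for which $G$ admits an edge irregular $k$-labeling. -}

module Defs where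

open import Data.Nat using (ℕ; _+_; _≤_; _<_; NonZero; suc)
open import Data.Nat.DivMod using (_%_)
open import Data.Fin using (Fin; toℕ)
open import Data.Product using (Σ; _×_)
open import Data.Sum using (_⊎_)
open import Relation.Binary.PropositionalEquality using (_≡_)

-- Cycle-star graph CS_{k,m} on Fin (k + m): vertices 0..k-1 form the cycle
-- 0-1-...-(k-1)-0, vertices k..k+m-1 are leaves all adjacent to vertex 0.
CycleEdge : (k : ℕ) .{{_ : NonZero k}} → ℕ → ℕ → Set
CycleEdge k a b = a < k × b < k × b ≡ suc a % k

LeafEdge : (k : ℕ) → ℕ → ℕ → Set
LeafEdge k a b = a ≡ 0 × k ≤ b

CSAdj : (k m : ℕ) .{{_ : NonZero k}} → Fin (k + m) → Fin (k + m) → Set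
CSAdj k m u v =
  CycleEdge k (toℕ u) (toℕ v) ⊎ CycleEdge k (toℕ v) (toℕ u)
  ⊎ LeafEdge k (toℕ u) (toℕ v) ⊎ LeafEdge k (toℕ v) (toℕ u)

IsLabeling : {N : ℕ} → ℕ → (Fin N → ℕ) → Set
IsLabeling K φ = ∀ v → 1 ≤ φ v × φ v ≤ K

EdgeIrregular : {N : ℕ} → (Fin N → Fin N → Set) → (Fin N → ℕ) → Set
EdgeIrregular Adj φ = ∀ u v x y → Adj u v → Adj x y →
  φ u + φ v ≡ φ x + φ y → (u ≡ x × v ≡ y) ⊎ (u ≡ y × v ≡ x)

HasEdgeIrregularLabeling : {N : ℕ} → (Fin N → Fin N → Set) → ℕ → Set
HasEdgeIrregularLabeling {N} Adj K =
  Σ (Fin N → ℕ) (λ φ → IsLabeling K φ × EdgeIrregular Adj φ)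

IsEdgeIrregularityStrength : {N : ℕ} → (Fin N → Fin N → Set) → ℕ → Set
IsEdgeIrregularityStrength Adj e =
  HasEdgeIrregularLabeling Adj e × (∀ K → HasEdgeIrregularLabeling Adj K → e ≤ K)

-- The d edges at a vertex have distinct weights iff their other ends carry distinct
-- labels, so a vertex of degree d forces es ≥ d; the hub of CS_{5,n−5} has degree
-- n − 3.  For n = 6 counting does better: e edges need e distinct weights in
-- [2, 2K], so 2K − 1 ≥ e = 6.  The matching labelings are explicit, and each is edge
-- irregular because every edge can be decoded from its weight.
module Submission where

open import Defs
open import Data.Nat using (ℕ; zero; suc; _+_; _∸_; _≤_; _<_; z≤n; s≤s; NonZero; _≤?_; _<?_)
open import Data.Nat.Properties
  using (+-comm; +-mono-≤; +-cancelˡ-≡; ≤-trans; ≤-refl; m≤m+n; m+[n∸m]≡n; m+n∸m≡n;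
         m+n∸n≡m; ∸-monoˡ-<; ∸-cancelʳ-≡; <⇒≢; n≮n; m≢1+m+n; m≤n⇒∃[o]m+o≡n)
  renaming (_≟_ to _≟ℕ_)
open import Data.Nat.DivMod using (_%_; n%n≡0)
open import Data.Fin using (Fin; zero; suc; toℕ; fromℕ; fromℕ<; _↑ˡ_; _↑ʳ_; #_)
open import Data.Fin.Properties
  using (_≟_; toℕ-injective; toℕ<n; toℕ-fromℕ; toℕ-fromℕ<; toℕ-↑ˡ; toℕ-↑ʳ; ↑ʳ-injective;
         fromℕ<-injective; suc-injective; injective⇒≤; all?)
open import Data.Vec using ([]; _∷_; lookup)
open import Data.Product using (Σ; _×_; _,_; proj₁; proj₂; swap; map₂)
open import Data.Sum using (_⊎_; inj₁; inj₂)
open import Data.Unit using (tt)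
open import Data.Empty using (⊥-elim)
open import Function using (_∘_)
open import Function.Definitions using (Injective)
open import Relation.Nullary using (Dec)
open import Relation.Nullary.Decidable using (toWitness; _×-dec_; _⊎-dec_; _→-dec_)
open import Relation.Binary.PropositionalEquality using (_≡_; _≢_; refl; sym; trans; cong; subst)

injective-bounded⇒≤ : ∀ {a lo hi} (f : Fin a → ℕ) → (∀ i → lo ≤ f i × f i ≤ hi) →
                      Injective _≡_ _≡_ f → a ≤ suc hi ∸ lo
injective-bounded⇒≤ {a} {lo} {hi} f bounded f-injective = injective⇒≤ shift-injective
  where
  shift< : ∀ i → f i ∸ lo < suc hi ∸ lo
  shift< i = ∸-monoˡ-< (s≤s (proj₂ (bounded i))) (proj₁ (bounded i))

  shift : Fin a → Fin (suc hi ∸ lo)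
  shift i = fromℕ< (shift< i)

  shift-injective : Injective _≡_ _≡_ shift
  shift-injective {i} {j} eq = f-injective (∸-cancelʳ-≡ (proj₁ (bounded i)) (proj₁ (bounded j))
    (fromℕ<-injective _ _ (shift< i) (shift< j) eq))

SameEdge : ∀ {N} → Fin N × Fin N → Fin N × Fin N → Set
SameEdge e f = (proj₁ e ≡ proj₁ f × proj₂ e ≡ proj₂ f) ⊎ (proj₁ e ≡ proj₂ f × proj₂ e ≡ proj₁ f)

sameEdge? : ∀ {N} (e f : Fin N × Fin N) → Dec (SameEdge e f)
sameEdge? (u , v) (x , y) = (u ≟ x ×-dec v ≟ y) ⊎-dec (u ≟ y ×-dec v ≟ x)

module _ {N K : ℕ} {Adj : Fin N → Fin N → Set} {φ : Fin N → ℕ}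
         (labeling : IsLabeling K φ) (irregular : EdgeIrregular Adj φ) where

  neighbours≤strength : ∀ {d} (v : Fin N) (g : Fin d → Fin N) →
                        Injective _≡_ _≡_ g → (∀ i → Adj v (g i)) → d ≤ K
  neighbours≤strength v g g-injective adjacent =
    injective-bounded⇒≤ (φ ∘ g) (labeling ∘ g) label-injective
    where
    label-injective : Injective _≡_ _≡_ (φ ∘ g)
    label-injective {i} {j} eq
      with irregular v (g i) v (g j) (adjacent i) (adjacent j) (cong (φ v +_) eq)
    ... | inj₁ (_ , gi≡gj) = g-injective gi≡gj
    ... | inj₂ (v≡gj , gi≡v) = g-injective (trans gi≡v v≡gj)

  edges≤strength : ∀ {e} (edge : Fin e → Fin N × Fin N) →
                   (∀ i → Adj (proj₁ (edge i)) (proj₂ (edge i))) →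
                   (∀ i j → SameEdge (edge i) (edge j) → i ≡ j) → e ≤ K + K ∸ 1
  edges≤strength {e} edge adjacent distinct = injective-bounded⇒≤ weight bounded weight-injective
    where
    weight : Fin e → ℕ
    weight i = φ (proj₁ (edge i)) + φ (proj₂ (edge i))

    bounded : ∀ i → 2 ≤ weight i × weight i ≤ K + K
    bounded i with labeling (proj₁ (edge i)) | labeling (proj₂ (edge i))
    ... | 1≤φu , φu≤K | 1≤φv , φv≤K = +-mono-≤ 1≤φu 1≤φv , +-mono-≤ φu≤K φv≤K

    weight-injective : Injective _≡_ _≡_ weight
    weight-injective {i} {j} eq = distinct i j (irregular _ _ _ _ (adjacent i) (adjacent j) eq)

cycleEdge? : ∀ k .{{_ : NonZero k}} a b → Dec (CycleEdge k a b)
cycleEdge? k a b = a <? k ×-dec b <? k ×-dec b ≟ℕ suc a % k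

leafEdge? : ∀ k a b → Dec (LeafEdge k a b)
leafEdge? k a b = a ≟ℕ 0 ×-dec k ≤? b

csAdj? : ∀ k m .{{_ : NonZero k}} (u v : Fin (k + m)) → Dec (CSAdj k m u v)
csAdj? k m u v = cycleEdge? k (toℕ u) (toℕ v) ⊎-dec cycleEdge? k (toℕ v) (toℕ u)
          ⊎-dec leafEdge? k (toℕ u) (toℕ v) ⊎-dec leafEdge? k (toℕ v) (toℕ u)

data CSEdge (k m : ℕ) : Set where
  cycle : Fin k → CSEdge k m
  leaf  : Fin m → CSEdge k m

module _ {k m : ℕ} .{{_ : NonZero k}} where

  endpoint₁ endpoint₂ : CSEdge k m → ℕ
  endpoint₁ (cycle i) = toℕ i
  endpoint₁ (leaf b)  = 0
  endpoint₂ (cycle i) = suc (toℕ i) % k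
  endpoint₂ (leaf b)  = k + toℕ b

  edgeIndex : CSEdge k m → ℕ
  edgeIndex (cycle i) = toℕ i
  edgeIndex (leaf b)  = k + toℕ b

  edgeIndex-injective : Injective _≡_ _≡_ edgeIndex
  edgeIndex-injective {cycle i} {cycle j} eq = cong cycle (toℕ-injective eq)
  edgeIndex-injective {cycle i} {leaf b}  eq = ⊥-elim (<⇒≢ (≤-trans (toℕ<n i) (m≤m+n k _)) eq)
  edgeIndex-injective {leaf b}  {cycle j} eq = ⊥-elim (<⇒≢ (≤-trans (toℕ<n j) (m≤m+n k _)) (sym eq))
  edgeIndex-injective {leaf b}  {leaf c}  eq = cong leaf (toℕ-injective (+-cancelˡ-≡ k _ _ eq))

  Directed : CSEdge k m → ℕ → ℕ → Set
  Directed e a b = a ≡ endpoint₁ e × b ≡ endpoint₂ e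

  Joins : CSEdge k m → ℕ → ℕ → Set
  Joins e a b = Directed e a b ⊎ Directed e b a

  cycleEdge⇒directed : ∀ {a b} → CycleEdge k a b → Σ (CSEdge k m) λ e → Directed e a b
  cycleEdge⇒directed {a} (a<k , _ , b≡) =
    cycle (fromℕ< a<k) , sym (toℕ-fromℕ< a<k) ,
    trans b≡ (cong (λ i → suc i % k) (sym (toℕ-fromℕ< a<k)))

  leafEdge⇒directed : ∀ {a b} → LeafEdge k a b → b < k + m → Σ (CSEdge k m) λ e → Directed e a b
  leafEdge⇒directed {a} {b} (a≡0 , k≤b) b<k+m =
    leaf (fromℕ< b∸k<m) , a≡0 , sym (trans (cong (k +_) (toℕ-fromℕ< b∸k<m)) (m+[n∸m]≡n k≤b))
    where
    b∸k<m : b ∸ k < m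
    b∸k<m = subst (b ∸ k <_) (m+n∸m≡n k m) (∸-monoˡ-< b<k+m k≤b)

  csAdj⇒joins : ∀ {u v} → CSAdj k m u v → Σ (CSEdge k m) λ e → Joins e (toℕ u) (toℕ v)
  csAdj⇒joins         (inj₁ uv)               = map₂ inj₁ (cycleEdge⇒directed uv)
  csAdj⇒joins         (inj₂ (inj₁ vu))        = map₂ inj₂ (cycleEdge⇒directed vu)
  csAdj⇒joins {u} {v} (inj₂ (inj₂ (inj₁ uv))) = map₂ inj₁ (leafEdge⇒directed uv (toℕ<n v))
  csAdj⇒joins {u} {v} (inj₂ (inj₂ (inj₂ vu))) = map₂ inj₂ (leafEdge⇒directed vu (toℕ<n u))

  directed⇒sameEnds : ∀ e {u v x y : Fin (k + m)} → Directed e (toℕ u) (toℕ v) →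
                      Directed e (toℕ x) (toℕ y) → u ≡ x × v ≡ y
  directed⇒sameEnds e (u≡ , v≡) (x≡ , y≡) =
    toℕ-injective (trans u≡ (sym x≡)) , toℕ-injective (trans v≡ (sym y≡))

  joins⇒sameEdge : ∀ e {u v x y : Fin (k + m)} → Joins e (toℕ u) (toℕ v) →
                   Joins e (toℕ x) (toℕ y) → SameEdge (u , v) (x , y)
  joins⇒sameEdge e (inj₁ uv) (inj₁ xy) = inj₁ (directed⇒sameEnds e uv xy)
  joins⇒sameEdge e (inj₁ uv) (inj₂ yx) = inj₂ (directed⇒sameEnds e uv yx)
  joins⇒sameEdge e (inj₂ vu) (inj₁ xy) = inj₂ (swap (directed⇒sameEnds e vu xy))
  joins⇒sameEdge e (inj₂ vu) (inj₂ yx) = inj₁ (swap (directed⇒sameEnds e vu yx))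

  weight : (ℕ → ℕ) → CSEdge k m → ℕ
  weight f e = f (endpoint₁ e) + f (endpoint₂ e)

  joins⇒weight : ∀ (f : ℕ → ℕ) e {a b} → Joins e a b → f a + f b ≡ weight f e
  joins⇒weight f e (inj₁ (refl , refl)) = refl
  joins⇒weight f e (inj₂ (refl , refl)) = +-comm (f (endpoint₂ e)) (f (endpoint₁ e))

  weightDecoding⇒injective : ∀ (f decode : ℕ → ℕ) → (∀ e → decode (weight f e) ≡ edgeIndex e) →
                             Injective _≡_ _≡_ (weight f)
  weightDecoding⇒injective f decode decodes {e} {e′} eq =
    edgeIndex-injective (trans (sym (decodes e)) (trans (cong decode eq) (decodes e′)))

  weight-injective⇒edgeIrregular : ∀ (f : ℕ → ℕ) → Injective _≡_ _≡_ (weight f) →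
                                   EdgeIrregular (CSAdj k m) (f ∘ toℕ)
  weight-injective⇒edgeIrregular f weight-injective u v x y uv xy eq
    with csAdj⇒joins uv | csAdj⇒joins xy
  ... | e , uv-joins | e′ , xy-joins
    with weight-injective {e} {e′}
           (trans (sym (joins⇒weight f e uv-joins)) (trans eq (joins⇒weight f e′ xy-joins)))
  ... | refl = joins⇒sameEdge e uv-joins xy-joins

cycleEdge-closing : ∀ k → CycleEdge (suc k) k 0
cycleEdge-closing k = ≤-refl , s≤s z≤n , sym (n%n≡0 (suc k))

module _ {k m : ℕ} where

  hubNeighbour : Fin (2 + m) → Fin (3 + k + m)
  hubNeighbour zero          = suc zero
  hubNeighbour (suc zero)    = suc (suc (fromℕ k ↑ˡ m))
  hubNeighbour (suc (suc b)) = (3 + k) ↑ʳ b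

  toℕ-lastCycleVertex : toℕ (fromℕ k ↑ˡ m) ≡ k
  toℕ-lastCycleVertex = trans (toℕ-↑ˡ (fromℕ k) m) (toℕ-fromℕ k)

  lastCycleVertex≢leaf : ∀ b → fromℕ k ↑ˡ m ≢ suc (k ↑ʳ b)
  lastCycleVertex≢leaf b eq =
    m≢1+m+n k (trans (sym toℕ-lastCycleVertex) (trans (cong toℕ eq) (cong suc (toℕ-↑ʳ k b))))

  hubNeighbour-injective : Injective _≡_ _≡_ hubNeighbour
  hubNeighbour-injective {zero}          {zero}          _  = refl
  hubNeighbour-injective {suc zero}      {suc zero}      _  = refl
  hubNeighbour-injective {suc zero}      {suc (suc b)}   eq =
    ⊥-elim (lastCycleVertex≢leaf b (suc-injective (suc-injective eq)))
  hubNeighbour-injective {suc (suc a)}   {suc zero}      eq =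
    ⊥-elim (lastCycleVertex≢leaf a (suc-injective (suc-injective (sym eq))))
  hubNeighbour-injective {suc (suc a)}   {suc (suc b)}   eq =
    cong (λ c → suc (suc c)) (↑ʳ-injective (3 + k) a b eq)
  hubNeighbour-injective {zero}          {suc zero}      ()
  hubNeighbour-injective {zero}          {suc (suc _)}   ()
  hubNeighbour-injective {suc zero}      {zero}          ()
  hubNeighbour-injective {suc (suc _)}   {zero}          ()

  hubNeighbour-adjacent : ∀ i → CSAdj (3 + k) m zero (hubNeighbour i)
  hubNeighbour-adjacent zero          = inj₁ (s≤s z≤n , s≤s (s≤s z≤n) , refl)
  hubNeighbour-adjacent (suc zero)    =
    inj₂ (inj₁ (subst (λ a → CycleEdge (3 + k) a 0) (cong (2 +_) (sym toℕ-lastCycleVertex))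
                      (cycleEdge-closing (2 + k))))
  hubNeighbour-adjacent (suc (suc b)) =
    inj₂ (inj₂ (inj₁ (refl , subst (3 + k ≤_) (sym (toℕ-↑ʳ (3 + k) b)) (m≤m+n (3 + k) (toℕ b)))))

  leaves+2≤strength : ∀ {K} → HasEdgeIrregularLabeling (CSAdj (3 + k) m) K → 2 + m ≤ K
  leaves+2≤strength (φ , labeling , irregular) =
    neighbours≤strength labeling irregular zero hubNeighbour
                        hubNeighbour-injective hubNeighbour-adjacent

edges-CS₅,₁ : Fin 6 → Fin 6 × Fin 6
edges-CS₅,₁ =
  lookup ((# 0 , # 1) ∷ (# 1 , # 2) ∷ (# 2 , # 3) ∷ (# 3 , # 4) ∷ (# 4 , # 0) ∷ (# 0 , # 5) ∷ [])

edges-CS₅,₁-adjacent : ∀ i → CSAdj 5 1 (proj₁ (edges-CS₅,₁ i)) (proj₂ (edges-CS₅,₁ i))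
edges-CS₅,₁-adjacent =
  toWitness {a? = all? λ i → csAdj? 5 1 (proj₁ (edges-CS₅,₁ i)) (proj₂ (edges-CS₅,₁ i))} tt

edges-CS₅,₁-distinct : ∀ i j → SameEdge (edges-CS₅,₁ i) (edges-CS₅,₁ j) → i ≡ j
edges-CS₅,₁-distinct =
  toWitness {a? = all? λ i → all? λ j → sameEdge? (edges-CS₅,₁ i) (edges-CS₅,₁ j) →-dec i ≟ j} tt

4≤strength-CS₅,₁ : ∀ {K} → HasEdgeIrregularLabeling (CSAdj 5 1) K → 4 ≤ K
4≤strength-CS₅,₁ {K} (φ , labeling , irregular) =
  6≤2K∸1⇒4≤K K
    (edges≤strength labeling irregular edges-CS₅,₁ edges-CS₅,₁-adjacent edges-CS₅,₁-distinct)
  where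
  6≤2K∸1⇒4≤K : ∀ K → 6 ≤ K + K ∸ 1 → 4 ≤ K
  6≤2K∸1⇒4≤K (suc (suc (suc (suc K)))) _ = s≤s (s≤s (s≤s (s≤s z≤n)))
  6≤2K∸1⇒4≤K (suc zero)             (s≤s ())
  6≤2K∸1⇒4≤K (suc (suc zero))       (s≤s (s≤s (s≤s ())))
  6≤2K∸1⇒4≤K (suc (suc (suc zero))) (s≤s (s≤s (s≤s (s≤s (s≤s ())))))

label-CS₅,₁ : ℕ → ℕ
label-CS₅,₁ 0 = 1
label-CS₅,₁ 1 = 1
label-CS₅,₁ 2 = 2
label-CS₅,₁ 3 = 4
label-CS₅,₁ 4 = 3
label-CS₅,₁ _ = 4

decodeWeight-CS₅,₁ : ℕ → ℕ
decodeWeight-CS₅,₁ 2 = 0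
decodeWeight-CS₅,₁ 3 = 1
decodeWeight-CS₅,₁ 6 = 2
decodeWeight-CS₅,₁ 7 = 3
decodeWeight-CS₅,₁ 4 = 4
decodeWeight-CS₅,₁ _ = 5

decodeWeight-CS₅,₁-weight : ∀ (e : CSEdge 5 1) →
                            decodeWeight-CS₅,₁ (weight label-CS₅,₁ e) ≡ edgeIndex e
decodeWeight-CS₅,₁-weight (cycle zero)                         = refl
decodeWeight-CS₅,₁-weight (cycle (suc zero))                   = refl
decodeWeight-CS₅,₁-weight (cycle (suc (suc zero)))             = refl
decodeWeight-CS₅,₁-weight (cycle (suc (suc (suc zero))))       = refl
decodeWeight-CS₅,₁-weight (cycle (suc (suc (suc (suc zero))))) = refl
decodeWeight-CS₅,₁-weight (leaf zero)                          = refl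

strength-CS₅,₁ : IsEdgeIrregularityStrength (CSAdj 5 1) 4
strength-CS₅,₁ =
  ( label-CS₅,₁ ∘ toℕ
  , toWitness {a? = all? λ v → 1 ≤? label-CS₅,₁ (toℕ v) ×-dec label-CS₅,₁ (toℕ v) ≤? 4} tt
  , weight-injective⇒edgeIrregular label-CS₅,₁
      (weightDecoding⇒injective label-CS₅,₁ decodeWeight-CS₅,₁ decodeWeight-CS₅,₁-weight))
  , λ K → 4≤strength-CS₅,₁

-- The hub gets the largest label, so its edges take the top weights 5 + j, 6 + j, …
-- and the three remaining cycle edges take 2, 3, 4.
hubLabel : ℕ → ℕ → ℕ
hubLabel j 0 = 4 + j
hubLabel j 1 = 1
hubLabel j 2 = 1
hubLabel j 3 = 2
hubLabel j 4 = 2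
hubLabel j (suc (suc (suc (suc (suc b))))) = 3 + b

hubLabel-bounded : ∀ j a → a < 7 + j → 1 ≤ hubLabel j a × hubLabel j a ≤ 4 + j
hubLabel-bounded j 0 _ = s≤s z≤n , ≤-refl
hubLabel-bounded j 1 _ = s≤s z≤n , s≤s z≤n
hubLabel-bounded j 2 _ = s≤s z≤n , s≤s z≤n
hubLabel-bounded j 3 _ = s≤s z≤n , s≤s (s≤s z≤n)
hubLabel-bounded j 4 _ = s≤s z≤n , s≤s (s≤s z≤n)
hubLabel-bounded j (suc (suc (suc (suc (suc b))))) (s≤s (s≤s (s≤s (s≤s (s≤s (s≤s b≤1+j)))))) =
  s≤s z≤n , s≤s (s≤s (s≤s b≤1+j))

decodeTopWeight : ℕ → ℕ
decodeTopWeight 0             = 0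
decodeTopWeight 1             = 4
decodeTopWeight (suc (suc b)) = 5 + b

decodeHubLabelWeight : ℕ → ℕ → ℕ
decodeHubLabelWeight j 2 = 1
decodeHubLabelWeight j 3 = 2
decodeHubLabelWeight j 4 = 3
decodeHubLabelWeight j (suc (suc (suc (suc (suc w))))) = decodeTopWeight (w ∸ j)
decodeHubLabelWeight j _ = 0

decodeHubLabelWeight-top : ∀ j c → decodeHubLabelWeight j (5 + (c + j)) ≡ decodeTopWeight c
decodeHubLabelWeight-top j c = cong decodeTopWeight (m+n∸n≡m c j)

decodeHubLabelWeight-weight : ∀ j (e : CSEdge 5 (2 + j)) →
                              decodeHubLabelWeight j (weight (hubLabel j) e) ≡ edgeIndex e
decodeHubLabelWeight-weight j (cycle zero) =
  trans (cong (decodeHubLabelWeight j ∘ (4 +_)) (+-comm j 1)) (decodeHubLabelWeight-top j 0)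
decodeHubLabelWeight-weight j (cycle (suc zero))                   = refl
decodeHubLabelWeight-weight j (cycle (suc (suc zero)))             = refl
decodeHubLabelWeight-weight j (cycle (suc (suc (suc zero))))       = refl
decodeHubLabelWeight-weight j (cycle (suc (suc (suc (suc zero))))) = decodeHubLabelWeight-top j 1
decodeHubLabelWeight-weight j (leaf b) =
  trans (cong (decodeHubLabelWeight j ∘ (4 +_)) (+-comm j (3 + toℕ b)))
        (decodeHubLabelWeight-top j (2 + toℕ b))

strength-CS₅,₂₊ : ∀ j → IsEdgeIrregularityStrength (CSAdj 5 (2 + j)) (4 + j)
strength-CS₅,₂₊ j =
  ( hubLabel j ∘ toℕ
  , (λ v → hubLabel-bounded j (toℕ v) (toℕ<n v))
  , weight-injective⇒edgeIrregular (hubLabel j)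
      (weightDecoding⇒injective (hubLabel j) (decodeHubLabelWeight j)
                                (decodeHubLabelWeight-weight j)))
  , λ K → leaves+2≤strength {k = 2}

theorem3p4 : (n : ℕ) → 6 ≤ n →
    (n ≡ 6 → IsEdgeIrregularityStrength (CSAdj 5 (n ∸ 5)) (n ∸ 2))
    × (7 ≤ n → IsEdgeIrregularityStrength (CSAdj 5 (n ∸ 5)) (n ∸ 3))
theorem3p4 n 6≤n with m≤n⇒∃[o]m+o≡n 6≤n
... | zero  , refl = (λ _ → strength-CS₅,₁) , λ 7≤6 → ⊥-elim (n≮n 6 7≤6)
... | suc j , refl = (λ ()) , λ _ → strength-CS₅,₂₊ j
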